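{- Let $G$ be a finite simple graph without isolated vertices. Then $G$ has at least one total restrained coalition partition, and $C_{tr}(G)\ge 2\,d_t^r(G)$.
   Context: For a graph $G=(V,E)$, a set $S\subseteq V$ is a total restrained dominating set (TRD-set) if every vertex of $V\setminus S$ is adjacent to at least one vertex of $S$ and to at least one other vertex of $V\setminus S$, and every vertex of $S$ is adjacent to at least one other vertex of $S$. Two disjoint sets $X,Y\subseteq V$ form a total restrained coalition if neither $X$ nor $Y$ is a TRD-set but $X\cup Y$ is a TRD-set. A total restrained coalition partition (trc-partition) of $G$ is a partition $\Phi=\{V_1,\dots,V_k\}$ of $V$ such that no $V_i$ is a TRD-set and each $V_i$ forms a total restrained coalition with some other $V_j\in\Phi$. $C_{tr}(G)$ denotes the maximum cardinality of a trc-partition of $G$. The total restrained domatic number $d_t^r(G)$ is the maximum number of sets in a partition of $V$ into TRD-sets. -}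

module Defs where

open import Data.Nat using (ℕ)
open import Data.Fin using (Fin)
open import Data.Bool using (Bool; true; false)
open import Data.Product using (Σ; ∃; ∃-syntax; _×_)
open import Data.Sum using (_⊎_)
open import Relation.Nullary using (¬_)
open import Relation.Binary.PropositionalEquality using (_≡_; _≢_)
open import Function.Definitions using (Surjective)

record Graph (n : ℕ) : Set where
  field
    adj   : Fin n → Fin n → Bool
    sym   : ∀ u v → adj u v ≡ adj v u
    irrefl : ∀ v → adj v v ≡ false

module _ {n : ℕ} (G : Graph n) where
  open Graph G

  Adj : Fin n → Fin n → Set
  Adj u v = adj u v ≡ true

  NoIsolated : Set
  NoIsolated = ∀ v → ∃[ u ] Adj v u

  IsTRD : (Fin n → Set) → Set
  IsTRD S =
    (∀ v → ¬ S v → (∃[ u ] (S u × Adj v u)) × (∃[ w ] (¬ S w × w ≢ v × Adj v w)))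
    × (∀ v → S v → ∃[ u ] (S u × u ≢ v × Adj v u))

  Cls : {k : ℕ} → (Fin n → Fin k) → Fin k → Fin n → Set
  Cls f i v = f v ≡ i

  IsPartition : {k : ℕ} → (Fin n → Fin k) → Set
  IsPartition f = Surjective _≡_ _≡_ f

  TRCoalition : (Fin n → Set) → (Fin n → Set) → Set
  TRCoalition X Y = ¬ IsTRD X × ¬ IsTRD Y × IsTRD (λ v → X v ⊎ Y v)

  IsTRCPartition : {k : ℕ} → (Fin n → Fin k) → Set
  IsTRCPartition {k} f =
    IsPartition f
    × (∀ i → ¬ IsTRD (Cls f i))
    × (∀ i → ∃[ j ] (j ≢ i × TRCoalition (Cls f i) (Cls f j)))

  IsTRDomaticPartition : {k : ℕ} → (Fin n → Fin k) → Set
  IsTRDomaticPartition {k} f = IsPartition f × (∀ i → IsTRD (Cls f i))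

  HasTRCPartition : ℕ → Set
  HasTRCPartition k = Σ (Fin n → Fin k) IsTRCPartition

  HasTRDomaticPartition : ℕ → Set
  HasTRDomaticPartition k = Σ (Fin n → Fin k) IsTRDomaticPartition

  IsCtr : ℕ → Set
  IsCtr c = HasTRCPartition c × (∀ k → HasTRCPartition k → k Data.Nat.≤ c)

  IsDtr : ℕ → Set
  IsDtr d = HasTRDomaticPartition d × (∀ k → HasTRDomaticPartition k → k Data.Nat.≤ d)

-- A TRD-set U splits into at least two nonempty parts that are not TRD-sets, each forming
-- a total restrained coalition with another part. Shrink U to a TRD-set X ⊆ U with a vertex
-- x such that X - x is not TRD, and let S = X - x and T = U ─ S, so x ∈ T. If T is not TRD,
-- take {S, T}, whose union is U. Otherwise let R = T - x: if R is not TRD, take {S, {x}, R},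
-- as S ∪ {x} = X and R ∪ {x} = T while a singleton is never TRD; if R is TRD, keep S and {x}
-- and split the smaller TRD-set R recursively. Splitting every class of a total restrained
-- domatic partition gives a trc-partition with at least twice as many classes, and
-- splitting V, a TRD-set as G has no isolated vertices, shows that trc-partitions exist.
module Submission where

open import Defs
open import Data.Bool using (true)
import Data.Bool as Bool
open import Data.Empty using (⊥-elim)
open import Data.Fin using (Fin; zero; suc; _≟_)
open import Data.Fin.Properties using (all?; any?)
import Data.Fin.Properties as Fin
open import Data.Fin.Subset
  using (Subset; _∈_; _∉_; _⊆_; _∪_; _─_; _-_; ⁅_⁆; ⊤; ∣_∣; Nonempty; inside; outside)
open import Data.Fin.Subset.Properties
  using ( _∈?_; nonempty?; drop-∷-⊆; ∈⊤; x∈⁅x⁆; x∈⁅y⁆⇒x≡y; p⊆q⇒∣p∣≤∣q∣; x∈p⇒∣p-x∣<∣p∣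
        ; ∪-comm; ∪-idem; x∈p∪q⁻; x∈p∪q⁺; x∈p∧x∉q⇒x∈p─q; p─q⊆p; x∈p∧x≢y⇒x∈p-y)
open import Data.List using (List; []; _∷_; _++_; length; lookup; tabulate)
open import Data.List.Properties using (length-++; length-tabulate)
open import Data.List.Membership.Propositional.Properties using (∈-lookup)
import Data.List.Relation.Binary.Subset.Propositional as List
open import Data.List.Relation.Binary.Subset.Propositional.Properties
  using (Any-resp-⊆; xs⊆xs++ys; xs⊆ys++xs)
open import Data.List.Relation.Unary.All as All using (All; []; _∷_)
import Data.List.Relation.Unary.All.Properties as All
open import Data.List.Relation.Unary.Any as Any using (Any; here; there)
open import Data.List.Relation.Unary.Any.Properties using (lookup-index)
open import Data.Nat using (ℕ; zero; suc; _+_; _*_; _≤_; _<_; z≤n; s≤s)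
open import Data.Nat.Induction using (<-wellFounded)
open import Data.Nat.Properties
  using ( suc-injective; +-assoc; ≤-refl; ≤-trans; <-≤-trans; +-mono-≤; *-distribˡ-+
        ; module ≤-Reasoning)
open import Data.Product using (∃-syntax; _×_; _,_; proj₁; proj₂)
open import Data.Sum as Sum using (_⊎_)
import Data.Vec as Vec
open import Data.Vec using ([]; _∷_; here; there)
open import Data.Vec.Properties using (lookup∘tabulate; []=⇒lookup; lookup⇒[]=)
open import Function using (_∘_; case_of_)
open import Induction.WellFounded using (Acc; acc)
open import Relation.Binary.PropositionalEquality
open import Relation.Nullary using (¬_; Dec; yes; no; does)
open import Relation.Nullary.Decidable using (_×-dec_; _→-dec_; ¬?; dec-true)
open import Relation.Unary using (_≐_)

private
  variable
    n d : ℕ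

x∈p─q⇒x∉q : ∀ {x} (p q : Subset n) → x ∈ p ─ q → x ∉ q
x∈p─q⇒x∉q (s ∷ p) (outside ∷ q) here         ()
x∈p─q⇒x∉q (s ∷ p) (t ∷ q)       (there x∈p─q) (there x∈q) = x∈p─q⇒x∉q p q x∈p─q x∈q

x∉p-x : ∀ {x} (p : Subset n) → x ∉ p - x
x∉p-x {x = x} p x∈p-x = x∈p─q⇒x∉q p ⁅ x ⁆ x∈p-x (x∈⁅x⁆ x)

p⊆q⇒p∪q─p≡q : ∀ {p q : Subset n} → p ⊆ q → p ∪ (q ─ p) ≡ q
p⊆q⇒p∪q─p≡q {p = []}          {q = []}          _   = refl
p⊆q⇒p∪q─p≡q {p = outside ∷ p} {q = s ∷ q}       p⊆q = cong (s ∷_) (p⊆q⇒p∪q─p≡q (drop-∷-⊆ p⊆q))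
p⊆q⇒p∪q─p≡q {p = inside ∷ p}  {q = inside ∷ q}  p⊆q = cong (inside ∷_) (p⊆q⇒p∪q─p≡q (drop-∷-⊆ p⊆q))
p⊆q⇒p∪q─p≡q {p = inside ∷ p}  {q = outside ∷ q} p⊆q with () ← p⊆q here

x∈p⇒⁅x⁆⊆p : ∀ {x} {p : Subset n} → x ∈ p → ⁅ x ⁆ ⊆ p
x∈p⇒⁅x⁆⊆p {x = x} x∈p y∈⁅x⁆ = subst (_∈ _) (sym (x∈⁅y⁆⇒x≡y x y∈⁅x⁆)) x∈p

x∈p⇒⁅x⁆∪p-x≡p : ∀ {x} {p : Subset n} → x ∈ p → ⁅ x ⁆ ∪ (p - x) ≡ p
x∈p⇒⁅x⁆∪p-x≡p x∈p = p⊆q⇒p∪q─p≡q (x∈p⇒⁅x⁆⊆p x∈p)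

indicator : Subset n → Fin n → ℕ
indicator p v with v ∈? p
... | yes _ = 1
... | no  _ = 0

indicator-∈ : ∀ {p : Subset n} {v} → v ∈ p → indicator p v ≡ 1
indicator-∈ {p = p} {v} v∈p with v ∈? p
... | yes _   = refl
... | no  v∉p = ⊥-elim (v∉p v∈p)

multiplicity : List (Subset n) → Fin n → ℕ
multiplicity []       v = 0
multiplicity (p ∷ ps) v = indicator p v + multiplicity ps v

infix 4 _≈ₘ_

record _≈ₘ_ (ps qs : List (Subset n)) : Set where
  constructor same-multiplicity
  field
    multiplicity≡ : ∀ v → multiplicity ps v ≡ multiplicity qs v

open _≈ₘ_

IsExactCover : List (Subset n) → Set
IsExactCover ps = ∀ v → multiplicity ps v ≡ 1

≈ₘ-refl : {ps : List (Subset n)} → ps ≈ₘ ps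
≈ₘ-refl = same-multiplicity λ _ → refl

≈ₘ-trans : {ps qs rs : List (Subset n)} → ps ≈ₘ qs → qs ≈ₘ rs → ps ≈ₘ rs
≈ₘ-trans ps≈qs qs≈rs = same-multiplicity λ v → trans (multiplicity≡ ps≈qs v) (multiplicity≡ qs≈rs v)

multiplicity-++ : ∀ (ps qs : List (Subset n)) v →
                  multiplicity (ps ++ qs) v ≡ multiplicity ps v + multiplicity qs v
multiplicity-++ []       qs v = refl
multiplicity-++ (p ∷ ps) qs v =
  trans (cong (indicator p v +_) (multiplicity-++ ps qs v)) (sym (+-assoc (indicator p v) _ _))

≈ₘ-++ : {ps qs ps′ qs′ : List (Subset n)} → ps ≈ₘ qs → ps′ ≈ₘ qs′ → ps ++ ps′ ≈ₘ qs ++ qs′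
≈ₘ-++ {ps = ps} {qs} {ps′} {qs′} ps≈qs ps′≈qs′ = same-multiplicity λ v → begin
  multiplicity (ps ++ ps′) v             ≡⟨ multiplicity-++ ps ps′ v ⟩
  multiplicity ps v + multiplicity ps′ v ≡⟨ cong₂ _+_ (multiplicity≡ ps≈qs v)
                                                       (multiplicity≡ ps′≈qs′ v) ⟩
  multiplicity qs v + multiplicity qs′ v ≡⟨ multiplicity-++ qs qs′ v ⟨
  multiplicity (qs ++ qs′) v             ∎
  where open ≡-Reasoning

p⊆q⇒p∷q─p≈ₘq : ∀ {p q : Subset n} → p ⊆ q → p ∷ (q ─ p) ∷ [] ≈ₘ q ∷ []
p⊆q⇒p∷q─p≈ₘq {p = p} {q} p⊆q = same-multiplicity counts
  where
  counts : ∀ v → multiplicity (p ∷ (q ─ p) ∷ []) v ≡ multiplicity (q ∷ []) v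
  counts v with v ∈? p | v ∈? q ─ p | v ∈? q
  ... | yes v∈p | yes v∈q─p | _       = ⊥-elim (x∈p─q⇒x∉q q p v∈q─p v∈p)
  ... | yes _   | no  _     | yes _   = refl
  ... | yes v∈p | no  _     | no v∉q  = ⊥-elim (v∉q (p⊆q v∈p))
  ... | no  _   | yes _     | yes _   = refl
  ... | no  _   | yes v∈q─p | no v∉q  = ⊥-elim (v∉q (p─q⊆p q p v∈q─p))
  ... | no v∉p  | no v∉q─p  | yes v∈q = ⊥-elim (v∉q─p (x∈p∧x∉q⇒x∈p─q v∈q v∉p))
  ... | no  _   | no  _     | no  _   = refl

multiplicity≡0 : ∀ {v} {ps : List (Subset n)} → All (v ∉_) ps → multiplicity ps v ≡ 0
multiplicity≡0                   []           = refl
multiplicity≡0 {v = v} {p ∷ ps} (v∉p ∷ v∉ps) with v ∈? p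
... | yes v∈p = ⊥-elim (v∉p v∈p)
... | no  _   = multiplicity≡0 v∉ps

multiplicity-tabulate : ∀ {v} (g : Fin d → Subset n) a → v ∈ g a → (∀ i → v ∈ g i → a ≡ i) →
                        multiplicity (tabulate g) v ≡ 1
multiplicity-tabulate {v = v} g zero v∈g₀ unique with v ∈? g zero
... | yes _   = cong suc (multiplicity≡0 (All.tabulate⁺ λ i v∈gᵢ → case unique (suc i) v∈gᵢ of λ ()))
... | no  v∉ = ⊥-elim (v∉ v∈g₀)
multiplicity-tabulate {v = v} g (suc a) v∈gₐ unique with v ∈? g zero
... | yes v∈g₀ = case unique zero v∈g₀ of λ ()
... | no  _    = multiplicity-tabulate (λ i → g (suc i)) a v∈gₐ
                   (λ i v∈gᵢ → Fin.suc-injective (unique (suc i) v∈gᵢ))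

multiplicity≡suc⇒Any : ∀ (ps : List (Subset n)) {v m} → multiplicity ps v ≡ suc m → Any (v ∈_) ps
multiplicity≡suc⇒Any (p ∷ ps) {v} eq with v ∈? p
... | yes v∈p = here v∈p
... | no  _   = there (multiplicity≡suc⇒Any ps eq)

multiplicity≡0⇒∉lookup : ∀ (ps : List (Subset n)) {v} i → multiplicity ps v ≡ 0 → v ∉ lookup ps i
multiplicity≡0⇒∉lookup (p ∷ ps) {v} i none v∈ with v ∈? p
multiplicity≡0⇒∉lookup (p ∷ ps) zero    none v∈ | no v∉p = v∉p v∈
multiplicity≡0⇒∉lookup (p ∷ ps) (suc i) none v∈ | no _   = multiplicity≡0⇒∉lookup ps i none v∈

∈-head⇒∉-tail : ∀ (ps : List (Subset n)) {p v} j → multiplicity (p ∷ ps) v ≡ 1 →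
                v ∈ p → v ∉ lookup ps j
∈-head⇒∉-tail ps {p} j once v∈p =
  multiplicity≡0⇒∉lookup ps j (suc-injective (trans (cong (_+ _) (sym (indicator-∈ v∈p))) once))

lookup-unique : ∀ (ps : List (Subset n)) {v i j} → multiplicity ps v ≡ 1 →
                v ∈ lookup ps i → v ∈ lookup ps j → i ≡ j
lookup-unique (p ∷ ps) {i = zero}  {zero}  _    _   _   = refl
lookup-unique (p ∷ ps) {i = zero}  {suc j} once v∈p v∈j = ⊥-elim (∈-head⇒∉-tail ps j once v∈p v∈j)
lookup-unique (p ∷ ps) {i = suc i} {zero}  once v∈i v∈p = ⊥-elim (∈-head⇒∉-tail ps i once v∈p v∈i)
lookup-unique (p ∷ ps) {v} {suc i} {suc j} once v∈i v∈j with v ∈? p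
... | yes _   = ⊥-elim (multiplicity≡0⇒∉lookup ps i (suc-injective once) v∈i)
... | no  _   = cong suc (lookup-unique ps once v∈i v∈j)

preimage : (Fin n → Fin d) → Fin d → Subset n
preimage f i = Vec.tabulate λ v → does (f v ≟ i)

∈-preimage⁺ : ∀ (f : Fin n → Fin d) {v i} → f v ≡ i → v ∈ preimage f i
∈-preimage⁺ f {v} {i} fv≡i =
  lookup⇒[]= v _ (trans (lookup∘tabulate _ v) (dec-true (f v ≟ i) fv≡i))

∈-preimage⁻ : ∀ (f : Fin n → Fin d) {v i} → v ∈ preimage f i → f v ≡ i
∈-preimage⁻ f {v} {i} v∈ with f v ≟ i | trans (sym (lookup∘tabulate _ v)) ([]=⇒lookup v∈)
... | yes fv≡i | _ = fv≡i
... | no  _    | ()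

module _ (G : Graph n) where
  open Graph G using (adj; irrefl)

  TRD : Subset n → Set
  TRD S = IsTRD G (_∈ S)

  TRD? : (S : Subset n) → Dec (TRD S)
  TRD? S =
    all? (λ v → ¬? (v ∈? S) →-dec
                  (any? (λ u → (u ∈? S) ×-dec adj? v u) ×-dec
                   any? (λ w → ¬? (w ∈? S) ×-dec ¬? (w ≟ v) ×-dec adj? v w)))
    ×-dec all? (λ v → (v ∈? S) →-dec any? (λ u → (u ∈? S) ×-dec ¬? (u ≟ v) ×-dec adj? v u))
    where
    adj? : ∀ u v → Dec (Adj G u v)
    adj? u v = adj u v Bool.≟ true

  IsTRD-resp-≐ : ∀ {A B : Fin n → Set} → A ≐ B → IsTRD G A → IsTRD G B
  IsTRD-resp-≐ (A⊆B , B⊆A) (dominated , total) =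
    (λ v v∉B → let (u , u∈A , adj-vu) , (w , w∉A , w≢v , adj-vw) = dominated v (v∉B ∘ A⊆B)
               in (u , A⊆B u∈A , adj-vu) , (w , w∉A ∘ B⊆A , w≢v , adj-vw)) ,
    (λ v v∈B → let u , u∈A , u≢v , adj-vu = total v (B⊆A v∈B) in u , A⊆B u∈A , u≢v , adj-vu)

  Adj⇒≢ : ∀ {u v} → Adj G v u → u ≢ v
  Adj⇒≢ {v = v} adj-vv refl with () ← trans (sym adj-vv) (irrefl v)

  ⊤-TRD : NoIsolated G → TRD ⊤
  ⊤-TRD noIsolated =
    (λ v v∉⊤ → ⊥-elim (v∉⊤ ∈⊤)) ,
    (λ v _ → let u , adj-vu = noIsolated v in u , ∈⊤ , Adj⇒≢ adj-vu , adj-vu)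

  ⁅x⁆-not-TRD : ∀ x → ¬ TRD ⁅ x ⁆
  ⁅x⁆-not-TRD x (_ , total) =
    let u , u∈⁅x⁆ , u≢x , _ = total x (x∈⁅x⁆ x) in u≢x (x∈⁅y⁆⇒x≡y x u∈⁅x⁆)

  TRD∧∉⇒Nonempty : ∀ {S v} → TRD S → v ∉ S → Nonempty S
  TRD∧∉⇒Nonempty (dominated , _) v∉S = let (u , u∈S , _) , _ = dominated _ v∉S in u , u∈S

  TRD⇒Nonempty-minus : ∀ {S x} → TRD S → x ∈ S → Nonempty (S - x)
  TRD⇒Nonempty-minus (_ , total) x∈S =
    let u , u∈S , u≢x , _ = total _ x∈S in u , x∈p∧x≢y⇒x∈p-y u∈S u≢x

  Coalitional : List (Subset n) → Subset n → Set
  Coalitional ps p = Nonempty p × ¬ TRD p × Any (λ q → TRD (p ∪ q)) ps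

  Coalitional-resp-⊆ : ∀ {ps qs p} → ps List.⊆ qs → Coalitional ps p → Coalitional qs p
  Coalitional-resp-⊆ ps⊆qs (nonempty , ¬TRD , partner) = nonempty , ¬TRD , Any-resp-⊆ ps⊆qs partner

  record CoalitionRefinement (qs : List (Subset n)) : Set where
    field
      parts       : List (Subset n)
      covers      : parts ≈ₘ qs
      coalitional : All (Coalitional parts) parts
      doubling    : 2 * length qs ≤ length parts

  open CoalitionRefinement

  refinement-++ : ∀ {qs qs′} → CoalitionRefinement qs → CoalitionRefinement qs′ →
                  CoalitionRefinement (qs ++ qs′)
  refinement-++ {qs} {qs′} r r′ = record
    { parts       = parts r ++ parts r′
    ; covers      = ≈ₘ-++ (covers r) (covers r′)
    ; coalitional = All.++⁺ (All.map (Coalitional-resp-⊆ (xs⊆xs++ys _ _)) (coalitional r))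
                            (All.map (Coalitional-resp-⊆ (xs⊆ys++xs _ _)) (coalitional r′))
    ; doubling    = begin
        2 * length (qs ++ qs′)               ≡⟨ cong (2 *_) (length-++ qs) ⟩
        2 * (length qs + length qs′)         ≡⟨ *-distribˡ-+ 2 (length qs) _ ⟩
        2 * length qs + 2 * length qs′       ≤⟨ +-mono-≤ (doubling r) (doubling r′) ⟩
        length (parts r) + length (parts r′) ≡⟨ length-++ (parts r) ⟨
        length (parts r ++ parts r′)         ∎
    }
    where open ≤-Reasoning

  record CriticalSubset (U : Subset n) : Set where
    field
      X        : Subset n
      x        : Fin n
      X⊆U      : X ⊆ U
      x∈X      : x ∈ X
      TRD-X    : TRD X
      ¬TRD-X-x : ¬ TRD (X - x)

  criticalSubset : ∀ {U u} → Acc _<_ ∣ U ∣ → TRD U → u ∈ U → CriticalSubset U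
  criticalSubset {U} {u} (acc smaller) TRD-U u∈U with TRD? (U - u)
  ... | no ¬TRD-U-u = record
    { X = U ; x = u ; X⊆U = λ v∈U → v∈U ; x∈X = u∈U ; TRD-X = TRD-U ; ¬TRD-X-x = ¬TRD-U-u }
  ... | yes TRD-U-u = record
    { X = X ; x = x ; X⊆U = λ v∈X → p─q⊆p U ⁅ u ⁆ (X⊆U v∈X)
    ; x∈X = x∈X ; TRD-X = TRD-X ; ¬TRD-X-x = ¬TRD-X-x }
    where
    open CriticalSubset
      (criticalSubset (smaller (x∈p⇒∣p-x∣<∣p∣ u∈U)) TRD-U-u (proj₂ (TRD∧∉⇒Nonempty TRD-U-u (x∉p-x U))))

  module Split {U : Subset n} (TRD-U : TRD U) (critical : CriticalSubset U) where
    open CriticalSubset critical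

    S T R : Subset n
    S = X - x
    T = U ─ S
    R = T - x

    S⊆U : S ⊆ U
    S⊆U v∈S = X⊆U (p─q⊆p X ⁅ x ⁆ v∈S)

    x∈T : x ∈ T
    x∈T = x∈p∧x∉q⇒x∈p─q (X⊆U x∈X) (x∉p-x X)

    ∣R∣<∣U∣ : ∣ R ∣ < ∣ U ∣
    ∣R∣<∣U∣ = <-≤-trans (x∈p⇒∣p-x∣<∣p∣ x∈T) (p⊆q⇒∣p∣≤∣q∣ (p─q⊆p U S))

    S∪T≡U : S ∪ T ≡ U
    S∪T≡U = p⊆q⇒p∪q─p≡q S⊆U

    ⁅x⁆∪S≡X : ⁅ x ⁆ ∪ S ≡ X
    ⁅x⁆∪S≡X = x∈p⇒⁅x⁆∪p-x≡p x∈X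

    ⁅x⁆∪R≡T : ⁅ x ⁆ ∪ R ≡ T
    ⁅x⁆∪R≡T = x∈p⇒⁅x⁆∪p-x≡p x∈T

    S∷⁅x⁆∷R≈ₘU : S ∷ ⁅ x ⁆ ∷ R ∷ [] ≈ₘ U ∷ []
    S∷⁅x⁆∷R≈ₘU = ≈ₘ-trans
      (≈ₘ-++ {ps = S ∷ []} ≈ₘ-refl (p⊆q⇒p∷q─p≈ₘq (x∈p⇒⁅x⁆⊆p x∈T)))
      (p⊆q⇒p∷q─p≈ₘq S⊆U)

    S-coalitional : ∀ rs → Coalitional (S ∷ ⁅ x ⁆ ∷ rs) S
    S-coalitional rs =
      TRD⇒Nonempty-minus TRD-X x∈X , ¬TRD-X-x ,
      there (here (subst TRD (sym (trans (∪-comm S ⁅ x ⁆) ⁅x⁆∪S≡X)) TRD-X))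

    ⁅x⁆-coalitional : ∀ rs → Coalitional (S ∷ ⁅ x ⁆ ∷ rs) ⁅ x ⁆
    ⁅x⁆-coalitional rs = (x , x∈⁅x⁆ x) , ⁅x⁆-not-TRD x , here (subst TRD (sym ⁅x⁆∪S≡X) TRD-X)

    refinement : (∀ {V} → ∣ V ∣ < ∣ U ∣ → TRD V → Nonempty V → CoalitionRefinement (V ∷ [])) →
                 CoalitionRefinement (U ∷ [])
    refinement recurse with TRD? T | TRD? R
    ... | no ¬TRD-T | _ = record
      { parts       = S ∷ T ∷ []
      ; covers      = p⊆q⇒p∷q─p≈ₘq S⊆U
      ; coalitional =
          (TRD⇒Nonempty-minus TRD-X x∈X , ¬TRD-X-x , there (here (subst TRD (sym S∪T≡U) TRD-U)))
        ∷ ((x , x∈T) , ¬TRD-T , here (subst TRD (sym (trans (∪-comm T S) S∪T≡U)) TRD-U))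
        ∷ []
      ; doubling    = ≤-refl
      }
    ... | yes TRD-T | no ¬TRD-R = record
      { parts       = S ∷ ⁅ x ⁆ ∷ R ∷ []
      ; covers      = S∷⁅x⁆∷R≈ₘU
      ; coalitional =
          S-coalitional (R ∷ [])
        ∷ ⁅x⁆-coalitional (R ∷ [])
        ∷ ( TRD⇒Nonempty-minus TRD-T x∈T , ¬TRD-R
          , there (here (subst TRD (sym (trans (∪-comm R ⁅ x ⁆) ⁅x⁆∪R≡T)) TRD-T)))
        ∷ []
      ; doubling    = s≤s (s≤s z≤n)
      }
    ... | yes TRD-T | yes TRD-R = record
      { parts       = S ∷ ⁅ x ⁆ ∷ parts rest
      ; covers      = ≈ₘ-trans (≈ₘ-++ {ps = S ∷ ⁅ x ⁆ ∷ []} ≈ₘ-refl (covers rest))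
                        S∷⁅x⁆∷R≈ₘU
      ; coalitional =
          S-coalitional (parts rest)
        ∷ ⁅x⁆-coalitional (parts rest)
        ∷ All.map (Coalitional-resp-⊆ (xs⊆ys++xs _ (S ∷ ⁅ x ⁆ ∷ []))) (coalitional rest)
      ; doubling    = s≤s (s≤s z≤n)
      }
      where
      rest : CoalitionRefinement (R ∷ [])
      rest = recurse ∣R∣<∣U∣ TRD-R (TRD⇒Nonempty-minus TRD-T x∈T)

  splitTRD : ∀ {U} → Acc _<_ ∣ U ∣ → TRD U → Nonempty U → CoalitionRefinement (U ∷ [])
  splitTRD (acc smaller) TRD-U (u , u∈U) =
    Split.refinement TRD-U (criticalSubset (<-wellFounded _) TRD-U u∈U)
                     (λ ∣V∣<∣U∣ → splitTRD (smaller ∣V∣<∣U∣))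

  IsTRDPartition : List (Subset n) → Set
  IsTRDPartition qs = IsExactCover qs × All (λ q → Nonempty q × TRD q) qs

  refineTRDPartition : ∀ {qs} → All (λ q → Nonempty q × TRD q) qs → CoalitionRefinement qs
  refineTRDPartition [] =
    record { parts = [] ; covers = ≈ₘ-refl ; coalitional = [] ; doubling = z≤n }
  refineTRDPartition ((nonempty , TRD-q) ∷ rest) =
    refinement-++ (splitTRD (<-wellFounded _) TRD-q nonempty) (refineTRDPartition rest)

  exactCover⇒TRCPartition : ∀ {ps} → IsExactCover ps → All (Coalitional ps) ps →
                            HasTRCPartition G (length ps)
  exactCover⇒TRCPartition {ps} exact coalitional-ps = class , surjective , ¬TRD-class , partner
    where
    class : Fin n → Fin (length ps)
    class v = Any.index (multiplicity≡suc⇒Any ps (exact v))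

    ∈-class : ∀ v → v ∈ lookup ps (class v)
    ∈-class v = lookup-index (multiplicity≡suc⇒Any ps (exact v))

    class≐ : ∀ i → Cls G class i ≐ (_∈ lookup ps i)
    class≐ i = (λ {v} class-v≡i → subst (λ j → v ∈ lookup ps j) class-v≡i (∈-class v))
             , (λ {v} v∈ → lookup-unique ps (exact v) (∈-class v) v∈)

    member : ∀ i → Coalitional ps (lookup ps i)
    member i = All.lookup coalitional-ps (∈-lookup i)

    ¬TRD-class : ∀ i → ¬ IsTRD G (Cls G class i)
    ¬TRD-class i TRD-class = proj₁ (proj₂ (member i)) (IsTRD-resp-≐ (class≐ i) TRD-class)

    surjective : IsPartition G class
    surjective i = let v , v∈ = proj₁ (member i) in v , λ { refl → proj₂ (class≐ i) v∈ }

    partner : ∀ i → ∃[ j ] (j ≢ i × TRCoalition G (Cls G class i) (Cls G class j))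
    partner i = j , j≢i , ¬TRD-class i , ¬TRD-class j , IsTRD-resp-≐ union≐ TRD-union
      where
      coalition = proj₂ (proj₂ (member i))
      j = Any.index coalition

      TRD-union : TRD (lookup ps i ∪ lookup ps j)
      TRD-union = lookup-index coalition

      j≢i : j ≢ i
      j≢i j≡i = proj₁ (proj₂ (member i))
        (subst TRD (∪-idem _) (subst (λ k → TRD (lookup ps i ∪ lookup ps k)) j≡i TRD-union))

      union≐ : (_∈ lookup ps i ∪ lookup ps j) ≐ (λ v → Cls G class i v ⊎ Cls G class j v)
      union≐ = (λ v∈ → Sum.map (proj₂ (class≐ i)) (proj₂ (class≐ j)) (x∈p∪q⁻ _ _ v∈))
             , (λ v∈ → x∈p∪q⁺ (Sum.map (proj₁ (class≐ i)) (proj₁ (class≐ j)) v∈))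

  TRDPartition⇒TRCPartition : ∀ {qs} → IsTRDPartition qs →
                              ∃[ k ] (2 * length qs ≤ k × HasTRCPartition G k)
  TRDPartition⇒TRCPartition (exact , members) =
    length (parts r) , doubling r ,
    exactCover⇒TRCPartition (λ v → trans (multiplicity≡ (covers r) v) (exact v)) (coalitional r)
    where
    r = refineTRDPartition members

  domatic⇒TRDPartition : HasTRDomaticPartition G d → ∃[ qs ] (length qs ≡ d × IsTRDPartition qs)
  domatic⇒TRDPartition (f , surjective , TRD-class) =
    tabulate (preimage f) , length-tabulate _ ,
    (λ v → multiplicity-tabulate (preimage f) (f v) (∈-preimage⁺ f refl) (λ _ → ∈-preimage⁻ f)) ,
    All.tabulate⁺ λ i →
      let v , fv≡i = surjective i in
      (v , ∈-preimage⁺ f (fv≡i refl)) , IsTRD-resp-≐ (∈-preimage⁺ f , ∈-preimage⁻ f) (TRD-class i)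

  noIsolated⇒TRDPartition : NoIsolated G → ∃[ qs ] IsTRDPartition qs
  noIsolated⇒TRDPartition noIsolated with nonempty? ⊤
  ... | yes nonempty =
    ⊤ ∷ [] , (λ v → multiplicity-tabulate {d = 1} (λ _ → ⊤) zero ∈⊤ λ { zero _ → refl }) ,
    (nonempty , ⊤-TRD noIsolated) ∷ []
  ... | no  empty    = [] , (λ v → ⊥-elim (empty (v , ∈⊤))) , []

theorem2p3 : ∀ {n} (G : Graph n) → NoIsolated G →
    (∃[ k ] HasTRCPartition G k)
    × (∀ d c → IsDtr G d → IsCtr G c → 2 * d ≤ c)
theorem2p3 G noIsolated = existence , bound
  where
  existence : ∃[ k ] HasTRCPartition G k
  existence = let _ , partition = noIsolated⇒TRDPartition G noIsolated
                  k , _ , trc = TRDPartition⇒TRCPartition G partition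
              in k , trc

  bound : ∀ d c → IsDtr G d → IsCtr G c → 2 * d ≤ c
  bound d c (domatic , _) (_ , maximal) =
    let qs , length-qs≡d , partition = domatic⇒TRDPartition G domatic
        k , 2|qs|≤k , trc = TRDPartition⇒TRCPartition G partition
    in ≤-trans (subst (λ m → 2 * m ≤ k) length-qs≡d 2|qs|≤k) (maximal k trc)
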